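{- Let $\vec{x}\in\mathbb{Z}^n$ be an Equal Subset Sum instance and let $\vec{c}\in\{ -1,0,1\}^n$ be a minimal-support solution with solution profile $\pi$ satisfying $\pi(0)\le n/3$ and $\pi(1)=\pi(-1)$, and let $\varepsilon$ be a non-negative constant with $\varepsilon < 1/12$. Then for every two distinct good solution pairs $(\vec{a},\vec{b}), (\vec{a}\,',\vec{b}\,') \in G(\vec{c})$ we have $\vec{a}\cdot\vec{x}\ne\vec{a}\,'\cdot\vec{x}$.
   Context: A solution of Equal Subset Sum on $\vec{x}$ is a nonzero $\vec{c}\in\{ -1,0,1\}^n$ with $\vec{c}\cdot\vec{x}=0$; its solution profile is $\pi(z)=|\{i:c_i=z\}|$. A minimal-support solution is one maximizing $\pi(0)$ among all nonzero solutions. For $\vec{c}$ and $\varepsilon$, the set of good solution pairs $G(\vec{c})\subseteq\{0,1,2\}^n\times\{0,1,2\}^n$ consists of all $(\vec{a},\vec{b})$ such that: (i) $\vec{a}$ and $\vec{b}$ each have exactly $n/2$ coordinates equal to $1$ and exactly $\varepsilon n$ coordinates equal to $2$; (ii) $\vec{a}-\vec{b}=\vec{c}$; (iii) for every $i$ with $c_i=0$, $(a_i,b_i)\in\{(0,0),(1,1)\}$.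
   Formalization: The non-negative constant ε ranges over the rationals below 1/12. -}

module Defs where

open import Data.Nat using (ℕ; zero; suc; _≤_)
open import Data.Integer as ℤ using (ℤ; +_; -[1+_]; _-_)
open import Data.Fin using (Fin; zero; suc)
open import Data.Product using (_×_; ∃-syntax)
open import Data.Sum using (_⊎_)
open import Data.Bool using (if_then_else_)
open import Relation.Nullary using (¬_; does)
open import Relation.Binary.PropositionalEquality using (_≡_)
open import Data.Rational as ℚ using (ℚ)

dot : ∀ {n} → (Fin n → ℤ) → (Fin n → ℤ) → ℤ
dot {zero}  u v = + 0
dot {suc n} u v = u zero ℤ.* v zero ℤ.+ dot (λ i → u (suc i)) (λ i → v (suc i))

count : ∀ {n} → (Fin n → ℤ) → ℤ → ℕ
count {zero}  v z = 0
count {suc n} v z =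
  (if does (v zero ℤ.≟ z) then 1 else 0) Data.Nat.+ count (λ i → v (suc i)) z

ℕtoℚ : ℕ → ℚ
ℕtoℚ m = (+ m) ℚ./ 1

IsTrit : ℤ → Set
IsTrit z = z ≡ -[1+ 0 ] ⊎ z ≡ + 0 ⊎ z ≡ + 1

Is012 : ℤ → Set
Is012 z = z ≡ + 0 ⊎ z ≡ + 1 ⊎ z ≡ + 2

IsSolution : ∀ {n} → (Fin n → ℤ) → (Fin n → ℤ) → Set
IsSolution x c = (∀ i → IsTrit (c i)) × (∃[ i ] ¬ (c i ≡ + 0)) × (dot c x ≡ + 0)

profile : ∀ {n} → (Fin n → ℤ) → ℤ → ℕ
profile c z = count c z

IsMinimalSupport : ∀ {n} → (Fin n → ℤ) → (Fin n → ℤ) → Set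
IsMinimalSupport x c =
  IsSolution x c × (∀ c' → IsSolution x c' → profile c' (+ 0) ≤ profile c (+ 0))

Balanced : ∀ {n} → ℚ → (Fin n → ℤ) → Set
Balanced {n} ε a =
  (∀ i → Is012 (a i)) × (2 Data.Nat.* count a (+ 1) ≡ n) × (ℕtoℚ (count a (+ 2)) ≡ ε ℚ.* ℕtoℚ n)

IsGoodPair : ∀ {n} → ℚ → (Fin n → ℤ) → (Fin n → ℤ) → (Fin n → ℤ) → Set
IsGoodPair ε c a b =
  Balanced ε a × Balanced ε b × (∀ i → a i - b i ≡ c i)
  × (∀ i → c i ≡ + 0 → (a i ≡ + 0 × b i ≡ + 0) ⊎ (a i ≡ + 1 × b i ≡ + 1))

-- Two distinct good pairs (a, b), (a', b') in G(c) with a·x = a'·x would make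
-- d = a − a' = b − b' a nonzero solution: its entries lie in {−1, 0, 1} because
-- every coordinate of a good pair is one of eight admissible pairs. Minimality of c
-- gives π_d(0) ≤ π_c(0) ≤ n/3. But every coordinate i has d_i = 0, c_i = 0, or a 2
-- in one of a, a', b, b' (if c_i = ±1 and no 2 occurs, a_i = a'_i is forced), so
-- n ≤ π_d(0) + π_c(0) + 4εn < 2n/3 + n/3 = n.
module Submission where

open import Defs
open import Data.Nat using (ℕ; _≤_)
open import Data.Integer using (ℤ; +_; -[1+_])
open import Data.Fin using (Fin)
open import Data.Product using (_×_)
open import Data.Rational as ℚ using (ℚ; 0ℚ)
open import Relation.Nullary using (¬_)
open import Relation.Binary.PropositionalEquality using (_≡_)

open import Algebra.Properties.CommutativeSemigroup using (interchange)
open import Data.Bool using (if_then_else_)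
open import Data.Empty using (⊥)
open import Data.Fin using (zero; suc)
open import Data.Fin.Properties using (¬∀⟶∃¬; nonZeroIndex)
open import Data.Integer as ℤ using (_-_)
import Data.Integer.Properties as ℤ
open import Data.Integer.Solver using (module +-*-Solver)
open import Data.List using (List; []; _∷_; map)
open import Data.List.Properties using (map-∘)
open import Data.List.Relation.Unary.Any using (Any; here; there)
open import Data.Nat as ℕ using (suc; _<_; _+_; _*_; z≤n; s≤s)
import Data.Nat.Properties as ℕ
open import Data.Nat.ListAction using (sum)
import Data.Nat.Solver as ℕ-Solver
open import Data.Product using (_,_; ∃; proj₁; proj₂; uncurry)
open import Data.Rational using (mkℚ; toℚᵘ)
import Data.Rational.Properties as ℚ
open import Data.Rational.Unnormalised as ℚᵘ using (mkℚᵘ; *≡*; *<*)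
import Data.Rational.Unnormalised.Properties as ℚᵘ
open import Data.Sum using (_⊎_; inj₁; inj₂)
open import Function using (_∘_)
open import Relation.Nullary using (does; _×-dec_)
open import Relation.Nullary.Decidable using (dec-true)
open import Relation.Binary.PropositionalEquality using (refl; sym; trans; cong; cong₂; subst)

data GoodEntry : ℤ → ℤ → ℤ → Set where
  e₀₀ : GoodEntry (+ 0) (+ 0) (+ 0)
  e₁₁ : GoodEntry (+ 0) (+ 1) (+ 1)
  e₁₀ : GoodEntry (+ 1) (+ 1) (+ 0)
  e₂₁ : GoodEntry (+ 1) (+ 2) (+ 1)
  e₀₁ : GoodEntry -[1+ 0 ] (+ 0) (+ 1)
  e₁₂ : GoodEntry -[1+ 0 ] (+ 1) (+ 2)
  e₂₀ : GoodEntry (+ 2) (+ 2) (+ 0)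
  e₀₂ : GoodEntry -[1+ 1 ] (+ 0) (+ 2)

goodEntry : ∀ {c a b} → Is012 a → Is012 b → a - b ≡ c →
  (c ≡ + 0 → (a ≡ + 0 × b ≡ + 0) ⊎ (a ≡ + 1 × b ≡ + 1)) → GoodEntry c a b
goodEntry (inj₁ refl)        (inj₁ refl)        refl _ = e₀₀
goodEntry (inj₁ refl)        (inj₂ (inj₁ refl)) refl _ = e₀₁
goodEntry (inj₁ refl)        (inj₂ (inj₂ refl)) refl _ = e₀₂
goodEntry (inj₂ (inj₁ refl)) (inj₁ refl)        refl _ = e₁₀
goodEntry (inj₂ (inj₁ refl)) (inj₂ (inj₁ refl)) refl _ = e₁₁
goodEntry (inj₂ (inj₁ refl)) (inj₂ (inj₂ refl)) refl _ = e₁₂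
goodEntry (inj₂ (inj₂ refl)) (inj₁ refl)        refl _ = e₂₀
goodEntry (inj₂ (inj₂ refl)) (inj₂ (inj₁ refl)) refl _ = e₂₁
goodEntry (inj₂ (inj₂ refl)) (inj₂ (inj₂ refl)) refl zero-pair with zero-pair refl
... | inj₁ (() , _)
... | inj₂ (() , _)

goodEntry-difference-trit : ∀ {c a b a' b'} →
  GoodEntry c a b → GoodEntry c a' b' → IsTrit (a - a')
goodEntry-difference-trit e₀₀ e₀₀ = inj₂ (inj₁ refl)
goodEntry-difference-trit e₀₀ e₁₁ = inj₁ refl
goodEntry-difference-trit e₁₁ e₀₀ = inj₂ (inj₂ refl)
goodEntry-difference-trit e₁₁ e₁₁ = inj₂ (inj₁ refl)
goodEntry-difference-trit e₁₀ e₁₀ = inj₂ (inj₁ refl)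
goodEntry-difference-trit e₁₀ e₂₁ = inj₁ refl
goodEntry-difference-trit e₂₁ e₁₀ = inj₂ (inj₂ refl)
goodEntry-difference-trit e₂₁ e₂₁ = inj₂ (inj₁ refl)
goodEntry-difference-trit e₀₁ e₀₁ = inj₂ (inj₁ refl)
goodEntry-difference-trit e₀₁ e₁₂ = inj₁ refl
goodEntry-difference-trit e₁₂ e₀₁ = inj₂ (inj₂ refl)
goodEntry-difference-trit e₁₂ e₁₂ = inj₂ (inj₁ refl)
goodEntry-difference-trit e₂₀ e₂₀ = inj₂ (inj₁ refl)
goodEntry-difference-trit e₀₂ e₀₂ = inj₂ (inj₁ refl)

goodEntry-cover : ∀ {c a b a' b'} → GoodEntry c a b → GoodEntry c a' b' →
  Any (uncurry _≡_)
      ((a - a' , + 0) ∷ (c , + 0) ∷ (a , + 2) ∷ (a' , + 2) ∷ (b , + 2) ∷ (b' , + 2) ∷ [])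
goodEntry-cover e₀₀ _   = there (here refl)
goodEntry-cover e₁₁ _   = there (here refl)
goodEntry-cover e₁₀ e₁₀ = here refl
goodEntry-cover e₁₀ e₂₁ = there (there (there (here refl)))
goodEntry-cover e₂₁ _   = there (there (here refl))
goodEntry-cover e₀₁ e₀₁ = here refl
goodEntry-cover e₀₁ e₁₂ = there (there (there (there (there (here refl)))))
goodEntry-cover e₁₂ _   = there (there (there (there (here refl))))
goodEntry-cover e₂₀ _   = there (there (here refl))
goodEntry-cover e₀₂ _   = there (there (there (there (here refl))))

same-difference-cancel : ∀ {a b a' b'} → a - b ≡ a' - b' → a - a' ≡ + 0 → a ≡ a' × b ≡ b'
same-difference-cancel {a} {b} {a'} {b'} a-b≡a'-b' a-a'≡0 = a≡a' , b≡b'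
  where
  open +-*-Solver
  a≡a' : a ≡ a'
  a≡a' = ℤ.i-j≡0⇒i≡j a a' a-a'≡0
  b≡b' : b ≡ b'
  b≡b' = trans (solve 2 (λ A B → B := A :- (A :- B)) refl a b)
        (trans (cong₂ _-_ a≡a' a-b≡a'-b') (solve 2 (λ A B → A :- (A :- B) := B) refl a' b'))

dot-difference : ∀ {n} (u v x : Fin n → ℤ) → dot (λ i → u i - v i) x ≡ dot u x - dot v x
dot-difference {ℕ.zero} u v x = refl
dot-difference {suc n}  u v x = begin
  (u zero - v zero) ℤ.* x zero ℤ.+ dot (λ i → u (suc i) - v (suc i)) (x ∘ suc)
    ≡⟨ cong (ℤ._+_ ((u zero - v zero) ℤ.* x zero)) (dot-difference (u ∘ suc) (v ∘ suc) (x ∘ suc)) ⟩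
  (u zero - v zero) ℤ.* x zero ℤ.+ (dot (u ∘ suc) (x ∘ suc) - dot (v ∘ suc) (x ∘ suc))
    ≡⟨ solve 5 (λ U V X DU DV → (U :- V) :* X :+ (DU :- DV) := (U :* X :+ DU) :- (V :* X :+ DV))
             refl (u zero) (v zero) (x zero) (dot (u ∘ suc) (x ∘ suc)) (dot (v ∘ suc) (x ∘ suc)) ⟩
  dot u x - dot v x ∎
  where
  open +-*-Solver
  open Relation.Binary.PropositionalEquality.≡-Reasoning

countAll : ∀ {n} → List ((Fin n → ℤ) × ℤ) → ℕ
countAll = sum ∘ map (uncurry count)

valuesAt : ∀ {n} → Fin n → List ((Fin n → ℤ) × ℤ) → List (ℤ × ℤ)
valuesAt i = map (λ (v , z) → (v i , z))

sum-map-+ : ∀ {A : Set} (f g : A → ℕ) (xs : List A) →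
  sum (map (λ x → f x + g x) xs) ≡ sum (map f xs) + sum (map g xs)
sum-map-+ f g []       = refl
sum-map-+ f g (x ∷ xs) =
  trans (cong (f x + g x ℕ.+_) (sum-map-+ f g xs)) (interchange ℕ.+-commutativeSemigroup (f x) (g x) _ _)

countAll-cover : ∀ {n} (vzs : List ((Fin n → ℤ) × ℤ)) →
  (∀ i → Any (uncurry _≡_) (valuesAt i vzs)) → n ≤ countAll vzs
countAll-cover {ℕ.zero} vzs cover = z≤n
countAll-cover {suc n}  vzs cover = begin
  1 + n                                                    ≤⟨ ℕ.+-mono-≤ (head-hit vzs (cover zero)) tail-bound ⟩
  sum (map isHead vzs) + sum (map (countPair ∘ shift) vzs) ≡⟨ sum-map-+ isHead (countPair ∘ shift) vzs ⟨
  countAll vzs                                             ∎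
  where
  open ℕ.≤-Reasoning
  countPair : (Fin n → ℤ) × ℤ → ℕ
  countPair = uncurry count
  isHead : (Fin (suc n) → ℤ) × ℤ → ℕ
  isHead (v , z) = if does (v zero ℤ.≟ z) then 1 else 0
  shift : (Fin (suc n) → ℤ) × ℤ → (Fin n → ℤ) × ℤ
  shift (v , z) = (v ∘ suc , z)
  head-hit : ∀ ws → Any (uncurry _≡_) (valuesAt zero ws) → 1 ≤ sum (map isHead ws)
  head-hit ((v , z) ∷ _) (here v0≡z) rewrite dec-true (v zero ℤ.≟ z) v0≡z = s≤s z≤n
  head-hit (w ∷ ws)      (there hit) = ℕ.≤-trans (head-hit ws hit) (ℕ.m≤n+m _ (isHead w))
  tail-bound : n ≤ sum (map (countPair ∘ shift) vzs)
  tail-bound = subst (n ≤_) (cong sum (sym (map-∘ vzs)))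
    (countAll-cover (map shift vzs) (λ i → subst (Any (uncurry _≡_)) (map-∘ vzs) (cover (suc i))))

density-bound : ∀ {n} k m .{{_ : ℕ.NonZero m}} (ε : ℚ) →
  ℕtoℚ k ≡ ε ℚ.* ℕtoℚ n → ε ℚ.< (+ 1) ℚ./ m → 0 < n → m * k < n
density-bound {n@(suc _)} k m@(suc _) ε@(mkℚ e d-1 _) k≡εn ε<1/m _ =
  ℤ.drop‿+<+ (ℤ.*-cancelʳ-<-nonNeg (+ d) (begin-strict
    + (m * k) ℤ.* + d      ≡⟨ cong (ℤ._* + d) (ℤ.pos-* m k) ⟩
    + m ℤ.* + k ℤ.* + d    ≡⟨ ℤ.*-assoc (+ m) (+ k) (+ d) ⟩
    + m ℤ.* (+ k ℤ.* + d)  ≡⟨ cong (+ m ℤ.*_) kd≡en ⟩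
    + m ℤ.* (e ℤ.* + n)    ≡⟨ solve 3 (λ M E N → M :* (E :* N) := (E :* M) :* N) refl (+ m) e (+ n) ⟩
    (e ℤ.* + m) ℤ.* + n    <⟨ ℤ.*-monoʳ-<-pos (+ n) em<d ⟩
    + d ℤ.* + n            ≡⟨ ℤ.*-comm (+ d) (+ n) ⟩
    + n ℤ.* + d            ∎))
  where
  open +-*-Solver
  open ℤ.≤-Reasoning
  d = suc d-1
  ℕtoℚ≃ : ∀ j → toℚᵘ (ℕtoℚ j) ℚᵘ.≃ mkℚᵘ (+ j) 0
  ℕtoℚ≃ j = ℚ.toℚᵘ-fromℚᵘ (mkℚᵘ (+ j) 0)
  kd≡en : + k ℤ.* + d ≡ e ℤ.* + n
  kd≡en with ℚᵘ.≃-trans (ℚᵘ.≃-sym (ℕtoℚ≃ k)) (ℚᵘ.≃-trans (ℚ.toℚᵘ-cong k≡εn)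
               (ℚᵘ.≃-trans (ℚ.toℚᵘ-homo-* ε (ℕtoℚ n)) (ℚᵘ.*-congˡ {mkℚᵘ e d-1} (ℕtoℚ≃ n))))
  ... | *≡* cross = trans (cong (λ j → + k ℤ.* + j) (sym (ℕ.*-identityʳ d))) (trans cross (ℤ.*-identityʳ _))
  em<d : e ℤ.* + m ℤ.< + d
  em<d with ℚᵘ.<-respʳ-≃ (ℚ.toℚᵘ-fromℚᵘ (mkℚᵘ (+ 1) (ℕ.pred m))) (ℚ.toℚᵘ-mono-< ε<1/m)
  ... | *<* em<1d = subst (e ℤ.* + m ℤ.<_) (ℤ.*-identityˡ (+ d)) em<1d

four-small-counts : ∀ {n} t₁ t₂ t₃ t₄ → 12 * t₁ < n → 12 * t₂ < n → 12 * t₃ < n → 12 * t₄ < n →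
  3 * (t₁ + (t₂ + (t₃ + (t₄ + 0)))) < n
four-small-counts {n} t₁ t₂ t₃ t₄ h₁ h₂ h₃ h₄ = ℕ.*-cancelˡ-< 4 _ _ (begin
  suc (4 * (3 * (t₁ + (t₂ + (t₃ + (t₄ + 0))))))
    ≤⟨ ℕ.m≤n+m _ 3 ⟩
  3 + suc (4 * (3 * (t₁ + (t₂ + (t₃ + (t₄ + 0))))))
    ≡⟨ solve 4 (λ a b c e → con 4 :+ con 4 :* (con 3 :* (a :+ (b :+ (c :+ (e :+ con 0)))))
                := (con 1 :+ con 12 :* a) :+ (con 1 :+ con 12 :* b) :+ (con 1 :+ con 12 :* c) :+ (con 1 :+ con 12 :* e))
             refl t₁ t₂ t₃ t₄ ⟩
  suc (12 * t₁) + suc (12 * t₂) + suc (12 * t₃) + suc (12 * t₄)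
    ≤⟨ ℕ.+-mono-≤ (ℕ.+-mono-≤ (ℕ.+-mono-≤ h₁ h₂) h₃) h₄ ⟩
  n + n + n + n
    ≡⟨ solve 1 (λ m → m :+ m :+ m :+ m := con 4 :* m) refl n ⟩
  4 * n ∎)
  where
  open ℕ-Solver.+-*-Solver
  open ℕ.≤-Reasoning

covering-too-small : ∀ {n z₁ z₂ t} → n ≤ z₁ + (z₂ + t) → z₁ ≤ z₂ → 3 * z₂ ≤ n → 3 * t < n → ⊥
covering-too-small {n} {z₁} {z₂} {t} n≤z₁+z₂+t z₁≤z₂ 3z₂≤n 3t<n = ℕ.<-irrefl refl (begin-strict
  3 * n               ≤⟨ ℕ.*-monoʳ-≤ 3 n≤z₁+z₂+t ⟩
  3 * (z₁ + (z₂ + t)) ≤⟨ ℕ.*-monoʳ-≤ 3 (ℕ.+-monoˡ-≤ (z₂ + t) z₁≤z₂) ⟩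
  3 * (z₂ + (z₂ + t)) ≡⟨ solve 2 (λ z s → con 3 :* (z :+ (z :+ s)) := con 2 :* (con 3 :* z) :+ con 3 :* s) refl z₂ t ⟩
  2 * (3 * z₂) + 3 * t <⟨ ℕ.+-mono-≤-< (ℕ.*-monoʳ-≤ 2 3z₂≤n) 3t<n ⟩
  2 * n + n           ≡⟨ solve 1 (λ m → con 2 :* m :+ m := con 3 :* m) refl n ⟩
  3 * n               ∎)
  where
  open ℕ-Solver.+-*-Solver
  open ℕ.≤-Reasoning

lemma7p4 : (n : ℕ) (x c : Fin n → ℤ) → IsMinimalSupport x c
    → 3 Data.Nat.* profile c (+ 0) ≤ n
    → profile c (+ 1) ≡ profile c -[1+ 0 ]
    → (ε : ℚ) → 0ℚ ℚ.≤ ε → ε ℚ.< (+ 1) ℚ./ 12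
    → (a b a' b' : Fin n → ℤ) → IsGoodPair ε c a b → IsGoodPair ε c a' b'
    → ¬ (∀ i → (a i ≡ a' i) × (b i ≡ b' i))
    → ¬ (dot a x ≡ dot a' x)
lemma7p4 n x c (_ , maximal) 3π₀≤n _ ε _ ε<1/12 a b a' b'
  (a-balanced , b-balanced , a-b≡c , zero-pair) (a'-balanced , b'-balanced , a'-b'≡c , zero-pair')
  distinct ax≡a'x =
  covering-too-small covered (maximal d d-solution) 3π₀≤n
    (four-small-counts (count a (+ 2)) (count a' (+ 2)) (count b (+ 2)) (count b' (+ 2))
      (sparse a-balanced) (sparse a'-balanced) (sparse b-balanced) (sparse b'-balanced))
  where
  entry : ∀ i → GoodEntry (c i) (a i) (b i)
  entry i = goodEntry (proj₁ a-balanced i) (proj₁ b-balanced i) (a-b≡c i) (zero-pair i)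
  entry' : ∀ i → GoodEntry (c i) (a' i) (b' i)
  entry' i = goodEntry (proj₁ a'-balanced i) (proj₁ b'-balanced i) (a'-b'≡c i) (zero-pair' i)
  d : Fin n → ℤ
  d i = a i - a' i
  differing : ∃ λ i → ¬ (a i ≡ a' i × b i ≡ b' i)
  differing = ¬∀⟶∃¬ n _ (λ i → (a i ℤ.≟ a' i) ×-dec (b i ℤ.≟ b' i)) distinct
  i₀ : Fin n
  i₀ = proj₁ differing
  d-solution : IsSolution x d
  d-solution = (λ i → goodEntry-difference-trit (entry i) (entry' i))
             , (i₀ , proj₂ differing ∘ same-difference-cancel (trans (a-b≡c i₀) (sym (a'-b'≡c i₀))))
             , trans (dot-difference a a' x) (trans (cong (_- dot a' x) ax≡a'x) (ℤ.+-inverseʳ (dot a' x)))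
  covered : n ≤ countAll ((d , + 0) ∷ (c , + 0) ∷ (a , + 2) ∷ (a' , + 2) ∷ (b , + 2) ∷ (b' , + 2) ∷ [])
  covered = countAll-cover _ (λ i → goodEntry-cover (entry i) (entry' i))
  sparse : ∀ {v} → Balanced ε v → 12 * count v (+ 2) < n
  sparse {v} (_ , _ , twos≡εn) =
    density-bound (count v (+ 2)) 12 ε twos≡εn ε<1/12 (ℕ.>-nonZero⁻¹ n {{nonZeroIndex i₀}})
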